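{- For pure formulae $G_1,\dots,G_m,F$ of a first-order language, $G_1,\dots,G_m\rhd_c F$ if and only if $F$ is a $tv$-semantic consequence of $G_1,\dots,G_m$, i.e. every $tv$-valuation of $\mathcal L(G_1,\dots,G_m,F)$ that $tv$-satisfies $G_1,\dots,G_m$ also $tv$-satisfies $F$.
   Context: A first-order language $\mathcal L$ has: a countable supply of variables (used for quantification), an infinite supply of individual parameters (free names that are never bound), constants, function symbols, relation symbols, the equality symbol $=$ and $\bot$. A term is pure if no variable occurs in it; a formula is pure if no variable occurs free in it. $F\{x/t\}$ denotes substitution of $t$ for free occurrences of $x$. $\mathcal L(G_1,\dots,G_m,F)$ is the language whose constant, function and relation symbols are those occurring in the given formulae (with $=$, $\bot$ and all individual parameters). $N_c$ is the usual (Gentzen/Prawitz) natural deduction system for classical first-order logic, except that $\forall$-elimination (from $\forall x F$ infer $F\{x/\mathbf y\}$) and $\exists$-introduction (from $F\{x/\mathbf y\}$ infer $\exists x F$) are restricted to $\mathbf y$ being a free variable or an individual parameter; $G_1,\dots,G_m\rhd_c F$ means there is a deduction in $N_c$ of $F$ with open assumptions among $G_1,\dots,G_m$. A $tv$-valuation of $\mathcal L$ is a total function $v$ from the pure atomic formulae of $\mathcal L$ (including equalities) to $\{\mathbf t,\mathbf f\}$ with $v(\bot)=\mathbf f$. It extends uniquely to $\bar v$ on all pure formulae by the classical two-valued truth tables for the connectives and: $\bar v(\forall x H)=\mathbf t$ iff $\bar v(H\{x/a\})=\mathbf t$ for every individual parameter $a$; $\bar v(\exists x H)=\mathbf t$ iff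 $\bar v(H\{x/a\})=\mathbf t$ for some individual parameter $a$. $v$ $tv$-satisfies a pure formula $F$ if $\bar v(F)=\mathbf t$. -}

module Defs where

open import Data.Nat using (ℕ; zero; suc)
open import Data.Fin using (Fin; zero; suc)
open import Data.Vec using (Vec; []; _∷_)
import Data.Vec.Relation.Unary.Any as VAny
import Data.List.Relation.Unary.Any as LAny
open import Data.List using (List; []; _∷_)
open import Data.List.Relation.Unary.All using (All)
open import Data.List.Membership.Propositional using (_∈_)
open import Data.Bool using (Bool; true; false; _∧_; _∨_; not)
open import Data.Product using (Σ; _×_; _,_)
open import Relation.Nullary using (¬_; Dec; yes; no; does)
open import Relation.Binary.PropositionalEquality using (_≡_)

record Signature : Set₁ where
  field
    Const    : Set
    Fun      : Set
    funArity : Fun → ℕ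
    Rel      : Set
    relArity : Rel → ℕ
open Signature public

-- Syntax (locally nameless, scoped).  `Term S n` / `Formula S n` may
-- contain bound variables `bvar i` for i < n (bound by enclosing
-- quantifiers), free variables `fvar x` and individual parameters
-- `par a`.  `Formula S 0` = the formulae of the language.

data Term (S : Signature) (n : ℕ) : Set where
  bvar : Fin n → Term S n
  fvar : ℕ → Term S n
  par  : ℕ → Term S n
  con  : Const S → Term S n
  app  : (f : Fun S) → Vec (Term S n) (funArity S f) → Term S n

infix  7 _≐_
infixr 6 _∧'_
infixr 5 _∨'_
infixr 4 _⇒'_

data Formula (S : Signature) : ℕ → Set where
  ⊥'   : ∀ {n} → Formula S n
  rel  : ∀ {n} (r : Rel S) → Vec (Term S n) (relArity S r) → Formula S n
  _≐_  : ∀ {n} → Term S n → Term S n → Formula S n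
  _∧'_ : ∀ {n} → Formula S n → Formula S n → Formula S n
  _∨'_ : ∀ {n} → Formula S n → Formula S n → Formula S n
  _⇒'_ : ∀ {n} → Formula S n → Formula S n → Formula S n
  ∀'   : ∀ {n} → Formula S (suc n) → Formula S n
  ∃'   : ∀ {n} → Formula S (suc n) → Formula S n

¬' : ∀ {S n} → Formula S n → Formula S n
¬' A = A ⇒' ⊥'

module _ {S : Signature} where

  mutual
    renT : ∀ {n m} → (Fin n → Fin m) → Term S n → Term S m
    renT ρ (bvar i)   = bvar (ρ i)
    renT ρ (fvar x)   = fvar x
    renT ρ (par a)    = par a
    renT ρ (con c)    = con c
    renT ρ (app f ts) = app f (renTs ρ ts)

    renTs : ∀ {n m k} → (Fin n → Fin m) → Vec (Term S n) k → Vec (Term S m) k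
    renTs ρ []       = []
    renTs ρ (t ∷ ts) = renT ρ t ∷ renTs ρ ts

  mutual
    substT : ∀ {n m} → (Fin n → Term S m) → Term S n → Term S m
    substT σ (bvar i)   = σ i
    substT σ (fvar x)   = fvar x
    substT σ (par a)    = par a
    substT σ (con c)    = con c
    substT σ (app f ts) = app f (substTs σ ts)

    substTs : ∀ {n m k} → (Fin n → Term S m) → Vec (Term S n) k → Vec (Term S m) k
    substTs σ []       = []
    substTs σ (t ∷ ts) = substT σ t ∷ substTs σ ts

  exts : ∀ {n m} → (Fin n → Term S m) → Fin (suc n) → Term S (suc m)
  exts σ zero    = bvar zero
  exts σ (suc i) = renT suc (σ i)

  substF : ∀ {n m} → (Fin n → Term S m) → Formula S n → Formula S m
  substF σ ⊥'         = ⊥'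
  substF σ (rel r ts) = rel r (substTs σ ts)
  substF σ (s ≐ t)    = substT σ s ≐ substT σ t
  substF σ (A ∧' B)   = substF σ A ∧' substF σ B
  substF σ (A ∨' B)   = substF σ A ∨' substF σ B
  substF σ (A ⇒' B)   = substF σ A ⇒' substF σ B
  substF σ (∀' A)     = ∀' (substF (exts σ) A)
  substF σ (∃' A)     = ∃' (substF (exts σ) A)

  _[_] : Formula S 1 → Term S 0 → Formula S 0
  F [ t ] = substF (λ _ → t) F

data Name : Set where
  fv : ℕ → Name
  pa : ℕ → Name

nameT : ∀ {S n} → Name → Term S n
nameT (fv x) = fvar x
nameT (pa a) = par a

data Sym (S : Signature) : Set where
  sfv  : ℕ → Sym S
  spar : ℕ → Sym S
  scon : Const S → Sym S
  sfun : Fun S → Sym S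
  srel : Rel S → Sym S

nameSym : ∀ {S} → Name → Sym S
nameSym (fv x) = sfv x
nameSym (pa a) = spar a

data OccT {S : Signature} {n : ℕ} : Sym S → Term S n → Set where
  o-fvar : ∀ {x} → OccT (sfv x) (fvar x)
  o-par  : ∀ {a} → OccT (spar a) (par a)
  o-con  : ∀ {c} → OccT (scon c) (con c)
  o-fun  : ∀ {f ts} → OccT (sfun f) (app f ts)
  o-arg  : ∀ {s f ts} → VAny.Any (OccT s) ts → OccT s (app f ts)

data OccF {S : Signature} : ∀ {n} → Sym S → Formula S n → Set where
  o-rel  : ∀ {n r} {ts : Vec (Term S n) _} → OccF (srel r) (rel r ts)
  o-rarg : ∀ {n s r} {ts : Vec (Term S n) _} → VAny.Any (OccT s) ts → OccF s (rel r ts)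
  o-eql  : ∀ {n s} {t u : Term S n} → OccT s t → OccF s (t ≐ u)
  o-eqr  : ∀ {n s} {t u : Term S n} → OccT s u → OccF s (t ≐ u)
  o-∧l   : ∀ {n s} {A B : Formula S n} → OccF s A → OccF s (A ∧' B)
  o-∧r   : ∀ {n s} {A B : Formula S n} → OccF s B → OccF s (A ∧' B)
  o-∨l   : ∀ {n s} {A B : Formula S n} → OccF s A → OccF s (A ∨' B)
  o-∨r   : ∀ {n s} {A B : Formula S n} → OccF s B → OccF s (A ∨' B)
  o-⇒l   : ∀ {n s} {A B : Formula S n} → OccF s A → OccF s (A ⇒' B)
  o-⇒r   : ∀ {n s} {A B : Formula S n} → OccF s B → OccF s (A ⇒' B)
  o-∀    : ∀ {n s} {A : Formula S (suc n)} → OccF s A → OccF s (∀' A)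
  o-∃    : ∀ {n s} {A : Formula S (suc n)} → OccF s A → OccF s (∃' A)

Pure : ∀ {S} → Formula S 0 → Set
Pure F = ∀ x → ¬ OccF (sfv x) F

-- No rules for `≐` (equality is treated like any relation symbol).
-- ∀E and ∃I are restricted to a free variable or parameter y.

Fresh : ∀ {S} → Name → List (Formula S 0) → Set
Fresh y Γ = All (λ G → ¬ OccF (nameSym y) G) Γ

infix 2 _⊢_

data _⊢_ {S : Signature} : List (Formula S 0) → Formula S 0 → Set where
  ass : ∀ {Γ A} → A ∈ Γ → Γ ⊢ A
  ∧I  : ∀ {Γ A B} → Γ ⊢ A → Γ ⊢ B → Γ ⊢ A ∧' B
  ∧E₁ : ∀ {Γ A B} → Γ ⊢ A ∧' B → Γ ⊢ A
  ∧E₂ : ∀ {Γ A B} → Γ ⊢ A ∧' B → Γ ⊢ B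
  ∨I₁ : ∀ {Γ A B} → Γ ⊢ A → Γ ⊢ A ∨' B
  ∨I₂ : ∀ {Γ A B} → Γ ⊢ B → Γ ⊢ A ∨' B
  ∨E  : ∀ {Γ A B C} → Γ ⊢ A ∨' B → (A ∷ Γ) ⊢ C → (B ∷ Γ) ⊢ C → Γ ⊢ C
  ⇒I  : ∀ {Γ A B} → (A ∷ Γ) ⊢ B → Γ ⊢ A ⇒' B
  ⇒E  : ∀ {Γ A B} → Γ ⊢ A ⇒' B → Γ ⊢ A → Γ ⊢ B
  ⊥I  : ∀ {Γ A} → Γ ⊢ ⊥' → Γ ⊢ A
  ⊥C  : ∀ {Γ A} → (¬' A ∷ Γ) ⊢ ⊥' → Γ ⊢ A
  ∀I  : ∀ {Γ} {F : Formula S 1} (y : Name) → Fresh y (∀' F ∷ Γ) →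
        Γ ⊢ F [ nameT y ] → Γ ⊢ ∀' F
  ∀E  : ∀ {Γ} {F : Formula S 1} (y : Name) → Γ ⊢ ∀' F → Γ ⊢ F [ nameT y ]
  ∃I  : ∀ {Γ} {F : Formula S 1} (y : Name) → Γ ⊢ F [ nameT y ] → Γ ⊢ ∃' F
  ∃E  : ∀ {Γ C} {F : Formula S 1} (y : Name) → Fresh y (∃' F ∷ C ∷ Γ) →
        Γ ⊢ ∃' F → (F [ nameT y ] ∷ Γ) ⊢ C → Γ ⊢ C

module _ {S : Signature} where

  data Atom : Set where
    ratom : (r : Rel S) → Vec (Term S 0) (relArity S r) → Atom
    eatom : Term S 0 → Term S 0 → Atom

  atomF : Atom → Formula S 0
  atomF (ratom r ts) = rel r ts
  atomF (eatom t u)  = t ≐ u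

  PureAtom : Atom → Set
  PureAtom A = Pure (atomF A)

  -- symbols of the language that are not always present
  data LangSym : Sym S → Set where
    l-con : ∀ {c} → LangSym (scon c)
    l-fun : ∀ {f} → LangSym (sfun f)
    l-rel : ∀ {r} → LangSym (srel r)

  InLang : List (Formula S 0) → Atom → Set
  InLang Δ A = ∀ s → LangSym s → OccF s (atomF A) → LAny.Any (OccF s) Δ

  -- tv-valuation of L(Δ): total function on pure atomic formulae of L(Δ)
  -- (v(⊥) = f is built into the evaluation below).
  Valuation : List (Formula S 0) → Set
  Valuation Δ = (A : Atom) → .(PureAtom A) → .(InLang Δ A) → Bool

LEM : Set₁
LEM = (P : Set) → Dec P

module _ {S : Signature} (lem : LEM) {Δ : List (Formula S 0)} (v : Valuation Δ) where

  -- value of v at an atom (junk value f outside the domain of v; never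
  -- used for pure formulae of L(Δ))
  atomVal : Atom → Bool
  atomVal A with lem (PureAtom A × InLang Δ A)
  ... | yes (p , l) = v A p l
  ... | no _        = false

  extEnv : ∀ {n} → ℕ → (Fin n → ℕ) → Fin (suc n) → ℕ
  extEnv a ρ zero    = a
  extEnv a ρ (suc i) = ρ i

  -- ⟦ F ⟧ ρ = v̄(F{bound variables/parameters given by ρ})
  ⟦_⟧ : ∀ {n} → Formula S n → (Fin n → ℕ) → Bool
  ⟦ ⊥' ⟧       ρ = false
  ⟦ rel r ts ⟧ ρ = atomVal (ratom r (substTs (λ i → par (ρ i)) ts))
  ⟦ t ≐ u ⟧    ρ = atomVal (eatom (substT (λ i → par (ρ i)) t) (substT (λ i → par (ρ i)) u))
  ⟦ A ∧' B ⟧   ρ = ⟦ A ⟧ ρ ∧ ⟦ B ⟧ ρ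
  ⟦ A ∨' B ⟧   ρ = ⟦ A ⟧ ρ ∨ ⟦ B ⟧ ρ
  ⟦ A ⇒' B ⟧   ρ = not (⟦ A ⟧ ρ) ∨ ⟦ B ⟧ ρ
  ⟦ ∀' A ⟧     ρ = does (lem ((a : ℕ) → ⟦ A ⟧ (extEnv a ρ) ≡ true))
  ⟦ ∃' A ⟧     ρ = does (lem (Σ ℕ (λ a → ⟦ A ⟧ (extEnv a ρ) ≡ true)))

  v̄ : Formula S 0 → Bool
  v̄ F = ⟦ F ⟧ (λ ())

TvConsequence : ∀ {S} → LEM → List (Formula S 0) → Formula S 0 → Set
TvConsequence lem Gs F =
  (v : Valuation (F ∷ Gs)) → All (λ G → v̄ lem v G ≡ true) Gs → v̄ lem v F ≡ true

-- Soundness is induction on derivations, reading every name as a parameter through an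
-- assignment; the eigenvariable conditions of ∀I and ∃E allow that assignment to be varied at
-- the eigenvariable. For completeness, if Gs ⊬ F then ¬F, Gs is consistent, and a
-- Lindenbaum–Henkin construction that runs only through the parameter instances of
-- subformulas of ¬F, Gs extends it to a set M deciding each of them, with a Henkin witness for
-- every existential it contains and a refuted instance for every universal it rejects. Since
-- quantifiers range over parameters, declaring an atom true iff it lies in M already gives a
-- tv-valuation of L(Gs, F) under which those instances are true exactly when they lie in M;
-- it satisfies Gs but not F.
module Submission where

open import Defs
open import Data.Bool using (Bool; true; false; _∧_; _∨_; not)
open import Data.Empty using (⊥-elim)
open import Data.Fin using (Fin; zero; suc)
open import Data.List using (List; []; _∷_; _++_; map; concatMap; upTo)
open import Data.List.Membership.Propositional using (_∈_)
open import Data.List.Membership.Propositional.Properties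
  using (∈-++⁺ˡ; ∈-++⁺ʳ; ∈-map⁺; ∈-concatMap⁺; ∈-upTo⁺)
open import Data.List.Relation.Binary.Subset.Propositional using (_⊆_)
open import Data.List.Relation.Unary.All as All using (All; []; _∷_)
open import Data.List.Relation.Unary.Any as ListAny using (here; there)
open import Data.Nat as ℕ using (ℕ; zero; suc; _⊔_; _<_; _≤_; _≤′_; ≤′-refl; ≤′-step)
open import Data.Nat.Properties
  using (≤-refl; ≤-trans; <⇒≱; ≤⇒≤′; m≤m⊔n; m≤n⊔m; m<n⇒m<n⊔o; m<n⇒m<o⊔n;
         m⊔n≤o⇒m≤o; m⊔n≤o⇒n≤o)
open import Data.Product using (Σ; _×_; _,_; proj₁; proj₂)
open import Data.Product.Function.NonDependent.Propositional using (_×-⇔_)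
open import Data.Sum as Sum using (_⊎_; inj₁; inj₂; map₁; [_,_]′)
open import Data.Sum.Function.Propositional using (_⊎-⇔_)
open import Data.Vec using (Vec; []; _∷_)
open import Data.Vec.Functional using () renaming (_∷_ to _∷ᵉ_)
open import Data.Vec.Relation.Unary.Any as VecAny using (here; there)
open import Function using (_∘_)
open import Function.Bundles using (_⇔_; mk⇔)
open Function.Bundles.Equivalence using (to; from)
open import Function.Properties.Equivalence using () renaming (sym to ⇔-sym; trans to ⇔-trans)
open import Function.Related.TypeIsomorphisms using (→-cong-⇔)
open import Relation.Binary.PropositionalEquality hiding ([_])
open import Relation.Nullary using (¬_; Dec; yes; no; does)
open import Relation.Nullary.Decidable using (does-⇔; map′)

module _ {S : Signature} where

  mutual
    substT-renT : ∀ {n m k} (τ : Fin m → Term S k) (π : Fin n → Fin m) (t : Term S n) →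
                  substT τ (renT π t) ≡ substT (λ i → τ (π i)) t
    substT-renT τ π (bvar i)   = refl
    substT-renT τ π (fvar x)   = refl
    substT-renT τ π (par a)    = refl
    substT-renT τ π (con c)    = refl
    substT-renT τ π (app f ts) = cong (app f) (substTs-renTs τ π ts)

    substTs-renTs : ∀ {n m k j} (τ : Fin m → Term S k) (π : Fin n → Fin m) (ts : Vec (Term S n) j) →
                    substTs τ (renTs π ts) ≡ substTs (λ i → τ (π i)) ts
    substTs-renTs τ π []       = refl
    substTs-renTs τ π (t ∷ ts) = cong₂ _∷_ (substT-renT τ π t) (substTs-renTs τ π ts)

  mutual
    renT-substT : ∀ {n m k} (π : Fin m → Fin k) (τ : Fin n → Term S m) (t : Term S n) →
                  renT π (substT τ t) ≡ substT (λ i → renT π (τ i)) t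
    renT-substT π τ (bvar i)   = refl
    renT-substT π τ (fvar x)   = refl
    renT-substT π τ (par a)    = refl
    renT-substT π τ (con c)    = refl
    renT-substT π τ (app f ts) = cong (app f) (renTs-substTs π τ ts)

    renTs-substTs : ∀ {n m k j} (π : Fin m → Fin k) (τ : Fin n → Term S m) (ts : Vec (Term S n) j) →
                    renTs π (substTs τ ts) ≡ substTs (λ i → renT π (τ i)) ts
    renTs-substTs π τ []       = refl
    renTs-substTs π τ (t ∷ ts) = cong₂ _∷_ (renT-substT π τ t) (renTs-substTs π τ ts)

  mutual
    substT-cong : ∀ {n m} {σ σ′ : Fin n → Term S m} → (∀ i → σ i ≡ σ′ i) → (t : Term S n) →
                  substT σ t ≡ substT σ′ t
    substT-cong e (bvar i)   = e i
    substT-cong e (fvar x)   = refl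
    substT-cong e (par a)    = refl
    substT-cong e (con c)    = refl
    substT-cong e (app f ts) = cong (app f) (substTs-cong e ts)

    substTs-cong : ∀ {n m j} {σ σ′ : Fin n → Term S m} → (∀ i → σ i ≡ σ′ i) → (ts : Vec (Term S n) j) →
                   substTs σ ts ≡ substTs σ′ ts
    substTs-cong e []       = refl
    substTs-cong e (t ∷ ts) = cong₂ _∷_ (substT-cong e t) (substTs-cong e ts)

  exts-cong : ∀ {n m} {σ σ′ : Fin n → Term S m} → (∀ i → σ i ≡ σ′ i) → ∀ i → exts σ i ≡ exts σ′ i
  exts-cong e zero    = refl
  exts-cong e (suc i) = cong (renT suc) (e i)

  substF-cong : ∀ {n m} {σ σ′ : Fin n → Term S m} → (∀ i → σ i ≡ σ′ i) → (H : Formula S n) →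
                substF σ H ≡ substF σ′ H
  substF-cong e ⊥'         = refl
  substF-cong e (rel r ts) = cong (rel r) (substTs-cong e ts)
  substF-cong e (s ≐ t)    = cong₂ _≐_ (substT-cong e s) (substT-cong e t)
  substF-cong e (A ∧' B)   = cong₂ _∧'_ (substF-cong e A) (substF-cong e B)
  substF-cong e (A ∨' B)   = cong₂ _∨'_ (substF-cong e A) (substF-cong e B)
  substF-cong e (A ⇒' B)   = cong₂ _⇒'_ (substF-cong e A) (substF-cong e B)
  substF-cong e (∀' A)     = cong ∀' (substF-cong (exts-cong e) A)
  substF-cong e (∃' A)     = cong ∃' (substF-cong (exts-cong e) A)

  mutual
    substT-substT : ∀ {n m k} (τ : Fin m → Term S k) (σ : Fin n → Term S m) (t : Term S n) →
                    substT τ (substT σ t) ≡ substT (λ i → substT τ (σ i)) t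
    substT-substT τ σ (bvar i)   = refl
    substT-substT τ σ (fvar x)   = refl
    substT-substT τ σ (par a)    = refl
    substT-substT τ σ (con c)    = refl
    substT-substT τ σ (app f ts) = cong (app f) (substTs-substTs τ σ ts)

    substTs-substTs : ∀ {n m k j} (τ : Fin m → Term S k) (σ : Fin n → Term S m) (ts : Vec (Term S n) j) →
                      substTs τ (substTs σ ts) ≡ substTs (λ i → substT τ (σ i)) ts
    substTs-substTs τ σ []       = refl
    substTs-substTs τ σ (t ∷ ts) = cong₂ _∷_ (substT-substT τ σ t) (substTs-substTs τ σ ts)

  exts-substT : ∀ {n m k} (τ : Fin m → Term S k) (σ : Fin n → Term S m) → ∀ i →
                exts (λ j → substT τ (σ j)) i ≡ substT (exts τ) (exts σ i)
  exts-substT τ σ zero    = refl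
  exts-substT τ σ (suc j) = trans (renT-substT suc τ (σ j)) (sym (substT-renT (exts τ) suc (σ j)))

  substF-substF : ∀ {n m k} (τ : Fin m → Term S k) (σ : Fin n → Term S m) (H : Formula S n) →
                  substF τ (substF σ H) ≡ substF (λ i → substT τ (σ i)) H
  substF-substF τ σ ⊥'         = refl
  substF-substF τ σ (rel r ts) = cong (rel r) (substTs-substTs τ σ ts)
  substF-substF τ σ (s ≐ t)    = cong₂ _≐_ (substT-substT τ σ s) (substT-substT τ σ t)
  substF-substF τ σ (A ∧' B)   = cong₂ _∧'_ (substF-substF τ σ A) (substF-substF τ σ B)
  substF-substF τ σ (A ∨' B)   = cong₂ _∨'_ (substF-substF τ σ A) (substF-substF τ σ B)
  substF-substF τ σ (A ⇒' B)   = cong₂ _⇒'_ (substF-substF τ σ A) (substF-substF τ σ B)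
  substF-substF τ σ (∀' A)     =
    cong ∀' (trans (substF-substF (exts τ) (exts σ) A) (sym (substF-cong (exts-substT τ σ) A)))
  substF-substF τ σ (∃' A)     =
    cong ∃' (trans (substF-substF (exts τ) (exts σ) A) (sym (substF-cong (exts-substT τ σ) A)))

  mutual
    substT-id : ∀ {n} {σ : Fin n → Term S n} → (∀ i → σ i ≡ bvar i) → (t : Term S n) → substT σ t ≡ t
    substT-id e (bvar i)   = e i
    substT-id e (fvar x)   = refl
    substT-id e (par a)    = refl
    substT-id e (con c)    = refl
    substT-id e (app f ts) = cong (app f) (substTs-id e ts)

    substTs-id : ∀ {n j} {σ : Fin n → Term S n} → (∀ i → σ i ≡ bvar i) → (ts : Vec (Term S n) j) →
                 substTs σ ts ≡ ts
    substTs-id e []       = refl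
    substTs-id e (t ∷ ts) = cong₂ _∷_ (substT-id e t) (substTs-id e ts)

  exts-id : ∀ {n} {σ : Fin n → Term S n} → (∀ i → σ i ≡ bvar i) → ∀ i → exts σ i ≡ bvar i
  exts-id e zero    = refl
  exts-id e (suc i) = cong (renT suc) (e i)

  substF-id : ∀ {n} {σ : Fin n → Term S n} → (∀ i → σ i ≡ bvar i) → (H : Formula S n) → substF σ H ≡ H
  substF-id e ⊥'         = refl
  substF-id e (rel r ts) = cong (rel r) (substTs-id e ts)
  substF-id e (s ≐ t)    = cong₂ _≐_ (substT-id e s) (substT-id e t)
  substF-id e (A ∧' B)   = cong₂ _∧'_ (substF-id e A) (substF-id e B)
  substF-id e (A ∨' B)   = cong₂ _∨'_ (substF-id e A) (substF-id e B)
  substF-id e (A ⇒' B)   = cong₂ _⇒'_ (substF-id e A) (substF-id e B)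
  substF-id e (∀' A)     = cong ∀' (substF-id (exts-id e) A)
  substF-id e (∃' A)     = cong ∃' (substF-id (exts-id e) A)

  substF-closed : (σ : Fin 0 → Term S 0) (H : Formula S 0) → substF σ H ≡ H
  substF-closed σ = substF-id (λ ())

  parEnv : ∀ {n} → (Fin n → ℕ) → Fin n → Term S 0
  parEnv ρ i = par (ρ i)

  closeF : ∀ {n} → (Fin n → ℕ) → Formula S n → Formula S 0
  closeF ρ = substF (parEnv ρ)

  closeF-inst : ∀ {n} (H : Formula S (suc n)) (ρ : Fin n → ℕ) (ρ′ : Fin (suc n) → ℕ) →
                (∀ i → ρ′ (suc i) ≡ ρ i) → substF (exts (parEnv ρ)) H [ par (ρ′ zero) ] ≡ closeF ρ′ H
  closeF-inst H ρ ρ′ e =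
    trans (substF-substF _ _ H) (substF-cong (λ { zero → refl ; (suc i) → cong par (sym (e i)) }) H)

module _ {S : Signature} where

  renT-nameT : ∀ {n m} (π : Fin n → Fin m) (y : Name) → renT π (nameT {S} y) ≡ nameT y
  renT-nameT π (fv x) = refl
  renT-nameT π (pa a) = refl

  substT-nameT : ∀ {n m} (τ : Fin n → Term S m) (y : Name) → substT τ (nameT y) ≡ nameT y
  substT-nameT τ (fv x) = refl
  substT-nameT τ (pa a) = refl

  mutual
    renameT : ∀ {n} → (Name → Name) → Term S n → Term S n
    renameT σ (bvar i)   = bvar i
    renameT σ (fvar x)   = nameT (σ (fv x))
    renameT σ (par a)    = nameT (σ (pa a))
    renameT σ (con c)    = con c
    renameT σ (app f ts) = app f (renameTs σ ts)

    renameTs : ∀ {n k} → (Name → Name) → Vec (Term S n) k → Vec (Term S n) k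
    renameTs σ []       = []
    renameTs σ (t ∷ ts) = renameT σ t ∷ renameTs σ ts

  renameF : ∀ {n} → (Name → Name) → Formula S n → Formula S n
  renameF σ ⊥'         = ⊥'
  renameF σ (rel r ts) = rel r (renameTs σ ts)
  renameF σ (s ≐ t)    = renameT σ s ≐ renameT σ t
  renameF σ (A ∧' B)   = renameF σ A ∧' renameF σ B
  renameF σ (A ∨' B)   = renameF σ A ∨' renameF σ B
  renameF σ (A ⇒' B)   = renameF σ A ⇒' renameF σ B
  renameF σ (∀' A)     = ∀' (renameF σ A)
  renameF σ (∃' A)     = ∃' (renameF σ A)

  renameT-nameT : ∀ {n} (σ : Name → Name) (y : Name) → renameT {n} σ (nameT y) ≡ nameT (σ y)
  renameT-nameT σ (fv x) = refl
  renameT-nameT σ (pa a) = refl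

  mutual
    renameT-renT : ∀ {n m} (σ : Name → Name) (π : Fin n → Fin m) (t : Term S n) →
                   renameT σ (renT π t) ≡ renT π (renameT σ t)
    renameT-renT σ π (bvar i)   = refl
    renameT-renT σ π (fvar x)   = sym (renT-nameT π (σ (fv x)))
    renameT-renT σ π (par a)    = sym (renT-nameT π (σ (pa a)))
    renameT-renT σ π (con c)    = refl
    renameT-renT σ π (app f ts) = cong (app f) (renameTs-renTs σ π ts)

    renameTs-renTs : ∀ {n m k} (σ : Name → Name) (π : Fin n → Fin m) (ts : Vec (Term S n) k) →
                     renameTs σ (renTs π ts) ≡ renTs π (renameTs σ ts)
    renameTs-renTs σ π []       = refl
    renameTs-renTs σ π (t ∷ ts) = cong₂ _∷_ (renameT-renT σ π t) (renameTs-renTs σ π ts)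

  mutual
    renameT-substT : ∀ {n m} (σ : Name → Name) (τ : Fin n → Term S m) (t : Term S n) →
                     renameT σ (substT τ t) ≡ substT (λ i → renameT σ (τ i)) (renameT σ t)
    renameT-substT σ τ (bvar i)   = refl
    renameT-substT σ τ (fvar x)   = sym (substT-nameT _ (σ (fv x)))
    renameT-substT σ τ (par a)    = sym (substT-nameT _ (σ (pa a)))
    renameT-substT σ τ (con c)    = refl
    renameT-substT σ τ (app f ts) = cong (app f) (renameTs-substTs σ τ ts)

    renameTs-substTs : ∀ {n m k} (σ : Name → Name) (τ : Fin n → Term S m) (ts : Vec (Term S n) k) →
                       renameTs σ (substTs τ ts) ≡ substTs (λ i → renameT σ (τ i)) (renameTs σ ts)
    renameTs-substTs σ τ []       = refl
    renameTs-substTs σ τ (t ∷ ts) = cong₂ _∷_ (renameT-substT σ τ t) (renameTs-substTs σ τ ts)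

  renameT-exts : ∀ {n m} (σ : Name → Name) (τ : Fin n → Term S m) → ∀ i →
                 renameT σ (exts τ i) ≡ exts (λ j → renameT σ (τ j)) i
  renameT-exts σ τ zero    = refl
  renameT-exts σ τ (suc j) = renameT-renT σ suc (τ j)

  renameF-substF : ∀ {n m} (σ : Name → Name) (τ : Fin n → Term S m) (H : Formula S n) →
                   renameF σ (substF τ H) ≡ substF (λ i → renameT σ (τ i)) (renameF σ H)
  renameF-substF σ τ ⊥'         = refl
  renameF-substF σ τ (rel r ts) = cong (rel r) (renameTs-substTs σ τ ts)
  renameF-substF σ τ (s ≐ t)    = cong₂ _≐_ (renameT-substT σ τ s) (renameT-substT σ τ t)
  renameF-substF σ τ (A ∧' B)   = cong₂ _∧'_ (renameF-substF σ τ A) (renameF-substF σ τ B)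
  renameF-substF σ τ (A ∨' B)   = cong₂ _∨'_ (renameF-substF σ τ A) (renameF-substF σ τ B)
  renameF-substF σ τ (A ⇒' B)   = cong₂ _⇒'_ (renameF-substF σ τ A) (renameF-substF σ τ B)
  renameF-substF σ τ (∀' A)     =
    cong ∀' (trans (renameF-substF σ (exts τ) A) (substF-cong (renameT-exts σ τ) (renameF σ A)))
  renameF-substF σ τ (∃' A)     =
    cong ∃' (trans (renameF-substF σ (exts τ) A) (substF-cong (renameT-exts σ τ) (renameF σ A)))

  renameF-inst : (σ : Name → Name) (F : Formula S 1) (y : Name) →
                 renameF σ (F [ nameT y ]) ≡ (renameF σ F) [ nameT (σ y) ]
  renameF-inst σ F y =
    trans (renameF-substF σ (λ _ → nameT y) F) (substF-cong (λ _ → renameT-nameT σ y) (renameF σ F))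

  mutual
    renameT-agree : ∀ {n} {σ σ′ : Name → Name} (t : Term S n) →
                    (∀ y → OccT (nameSym y) t → σ y ≡ σ′ y) → renameT σ t ≡ renameT σ′ t
    renameT-agree (bvar i)   h = refl
    renameT-agree (fvar x)   h = cong nameT (h (fv x) o-fvar)
    renameT-agree (par a)    h = cong nameT (h (pa a) o-par)
    renameT-agree (con c)    h = refl
    renameT-agree (app f ts) h = cong (app f) (renameTs-agree ts (λ y o → h y (o-arg o)))

    renameTs-agree : ∀ {n k} {σ σ′ : Name → Name} (ts : Vec (Term S n) k) →
                     (∀ y → VecAny.Any (OccT (nameSym y)) ts → σ y ≡ σ′ y) → renameTs σ ts ≡ renameTs σ′ ts
    renameTs-agree []       h = refl
    renameTs-agree (t ∷ ts) h =
      cong₂ _∷_ (renameT-agree t (λ y o → h y (here o))) (renameTs-agree ts (λ y o → h y (there o)))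

  renameF-agree : ∀ {n} {σ σ′ : Name → Name} (H : Formula S n) →
                  (∀ y → OccF (nameSym y) H → σ y ≡ σ′ y) → renameF σ H ≡ renameF σ′ H
  renameF-agree ⊥'         h = refl
  renameF-agree (rel r ts) h = cong (rel r) (renameTs-agree ts (λ y o → h y (o-rarg o)))
  renameF-agree (s ≐ t)    h =
    cong₂ _≐_ (renameT-agree s (λ y o → h y (o-eql o))) (renameT-agree t (λ y o → h y (o-eqr o)))
  renameF-agree (A ∧' B)   h =
    cong₂ _∧'_ (renameF-agree A (λ y o → h y (o-∧l o))) (renameF-agree B (λ y o → h y (o-∧r o)))
  renameF-agree (A ∨' B)   h =
    cong₂ _∨'_ (renameF-agree A (λ y o → h y (o-∨l o))) (renameF-agree B (λ y o → h y (o-∨r o)))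
  renameF-agree (A ⇒' B)   h =
    cong₂ _⇒'_ (renameF-agree A (λ y o → h y (o-⇒l o))) (renameF-agree B (λ y o → h y (o-⇒r o)))
  renameF-agree (∀' A)     h = cong ∀' (renameF-agree A (λ y o → h y (o-∀ o)))
  renameF-agree (∃' A)     h = cong ∃' (renameF-agree A (λ y o → h y (o-∃ o)))

  mutual
    renameT-id : ∀ {n} (t : Term S n) → renameT (λ y → y) t ≡ t
    renameT-id (bvar i)   = refl
    renameT-id (fvar x)   = refl
    renameT-id (par a)    = refl
    renameT-id (con c)    = refl
    renameT-id (app f ts) = cong (app f) (renameTs-id ts)

    renameTs-id : ∀ {n k} (ts : Vec (Term S n) k) → renameTs (λ y → y) ts ≡ ts
    renameTs-id []       = refl
    renameTs-id (t ∷ ts) = cong₂ _∷_ (renameT-id t) (renameTs-id ts)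

  renameF-id : ∀ {n} (H : Formula S n) → renameF (λ y → y) H ≡ H
  renameF-id ⊥'         = refl
  renameF-id (rel r ts) = cong (rel r) (renameTs-id ts)
  renameF-id (s ≐ t)    = cong₂ _≐_ (renameT-id s) (renameT-id t)
  renameF-id (A ∧' B)   = cong₂ _∧'_ (renameF-id A) (renameF-id B)
  renameF-id (A ∨' B)   = cong₂ _∨'_ (renameF-id A) (renameF-id B)
  renameF-id (A ⇒' B)   = cong₂ _⇒'_ (renameF-id A) (renameF-id B)
  renameF-id (∀' A)     = cong ∀' (renameF-id A)
  renameF-id (∃' A)     = cong ∃' (renameF-id A)

  renameF-fresh : ∀ {n} {σ σ′ : Name → Name} {y : Name} (H : Formula S n) → ¬ OccF (nameSym y) H →
                  (∀ z → z ≢ y → σ′ z ≡ σ z) → renameF σ′ H ≡ renameF σ H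
  renameF-fresh H y∉H σ′≗σ = renameF-agree H (λ z z∈H → σ′≗σ z (λ { refl → y∉H z∈H }))

  renameF-inst-fresh : {σ σ′ : Name → Name} {y : Name} (F : Formula S 1) → ¬ OccF (nameSym y) F →
                       (∀ z → z ≢ y → σ′ z ≡ σ z) →
                       renameF σ′ (F [ nameT y ]) ≡ (renameF σ F) [ nameT (σ′ y) ]
  renameF-inst-fresh {σ′ = σ′} {y} F y∉F σ′≗σ =
    trans (renameF-inst σ′ F y) (cong (_[ nameT (σ′ y) ]) (renameF-fresh F y∉F σ′≗σ))

  renameF-pure : {σ : Name → Name} (G : Formula S 0) → Pure G → (∀ a → σ (pa a) ≡ pa a) →
                 renameF σ G ≡ G
  renameF-pure G pure σ-fixes-pars =
    trans (renameF-agree G λ { (fv x) o → ⊥-elim (pure x o) ; (pa a) o → σ-fixes-pars a }) (renameF-id G)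

module _ {S : Signature} where

  mutual
    parBoundT : ∀ {n} → Term S n → ℕ
    parBoundT (bvar i)   = 0
    parBoundT (fvar x)   = 0
    parBoundT (par a)    = suc a
    parBoundT (con c)    = 0
    parBoundT (app f ts) = parBoundTs ts

    parBoundTs : ∀ {n k} → Vec (Term S n) k → ℕ
    parBoundTs []       = 0
    parBoundTs (t ∷ ts) = parBoundT t ⊔ parBoundTs ts

  parBoundF : ∀ {n} → Formula S n → ℕ
  parBoundF ⊥'         = 0
  parBoundF (rel r ts) = parBoundTs ts
  parBoundF (s ≐ t)    = parBoundT s ⊔ parBoundT t
  parBoundF (A ∧' B)   = parBoundF A ⊔ parBoundF B
  parBoundF (A ∨' B)   = parBoundF A ⊔ parBoundF B
  parBoundF (A ⇒' B)   = parBoundF A ⊔ parBoundF B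
  parBoundF (∀' A)     = parBoundF A
  parBoundF (∃' A)     = parBoundF A

  mutual
    parBoundT-occ : ∀ {n a} (t : Term S n) → OccT (spar a) t → a < parBoundT t
    parBoundT-occ (par a)    o-par     = ≤-refl
    parBoundT-occ (app f ts) (o-arg o) = parBoundTs-occ ts o

    parBoundTs-occ : ∀ {n k a} (ts : Vec (Term S n) k) → VecAny.Any (OccT (spar a)) ts → a < parBoundTs ts
    parBoundTs-occ (t ∷ ts) (here o)  = m<n⇒m<n⊔o _ (parBoundT-occ t o)
    parBoundTs-occ (t ∷ ts) (there o) = m<n⇒m<o⊔n (parBoundT t) (parBoundTs-occ ts o)

  parBoundF-occ : ∀ {n a} (H : Formula S n) → OccF (spar a) H → a < parBoundF H
  parBoundF-occ (rel r ts) (o-rarg o) = parBoundTs-occ ts o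
  parBoundF-occ (s ≐ t)    (o-eql o)  = m<n⇒m<n⊔o _ (parBoundT-occ s o)
  parBoundF-occ (s ≐ t)    (o-eqr o)  = m<n⇒m<o⊔n (parBoundT s) (parBoundT-occ t o)
  parBoundF-occ (A ∧' B)   (o-∧l o)   = m<n⇒m<n⊔o _ (parBoundF-occ A o)
  parBoundF-occ (A ∧' B)   (o-∧r o)   = m<n⇒m<o⊔n (parBoundF A) (parBoundF-occ B o)
  parBoundF-occ (A ∨' B)   (o-∨l o)   = m<n⇒m<n⊔o _ (parBoundF-occ A o)
  parBoundF-occ (A ∨' B)   (o-∨r o)   = m<n⇒m<o⊔n (parBoundF A) (parBoundF-occ B o)
  parBoundF-occ (A ⇒' B)   (o-⇒l o)   = m<n⇒m<n⊔o _ (parBoundF-occ A o)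
  parBoundF-occ (A ⇒' B)   (o-⇒r o)   = m<n⇒m<o⊔n (parBoundF A) (parBoundF-occ B o)
  parBoundF-occ (∀' A)     (o-∀ o)    = parBoundF-occ A o
  parBoundF-occ (∃' A)     (o-∃ o)    = parBoundF-occ A o

  freshPar : List (Formula S 0) → ℕ
  freshPar []      = 0
  freshPar (G ∷ Γ) = parBoundF G ⊔ freshPar Γ

  freshPar-≤-fresh : ∀ {a} (Γ : List (Formula S 0)) → freshPar Γ ≤ a → Fresh (pa a) Γ
  freshPar-≤-fresh []      _ = []
  freshPar-≤-fresh (G ∷ Γ) b =
    (λ o → <⇒≱ (parBoundF-occ G o) (m⊔n≤o⇒m≤o (parBoundF G) _ b))
    ∷ freshPar-≤-fresh Γ (m⊔n≤o⇒n≤o (parBoundF G) _ b)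

  freshPar-fresh : (Γ : List (Formula S 0)) → Fresh (pa (freshPar Γ)) Γ
  freshPar-fresh Γ = freshPar-≤-fresh Γ ≤-refl

module _ {S : Signature} where

  mutual
    OccT-renT : ∀ {n m s} (π : Fin n → Fin m) (t : Term S n) → OccT s (renT π t) → OccT s t
    OccT-renT π (fvar x)   o-fvar    = o-fvar
    OccT-renT π (par a)    o-par     = o-par
    OccT-renT π (con c)    o-con     = o-con
    OccT-renT π (app f ts) o-fun     = o-fun
    OccT-renT π (app f ts) (o-arg o) = o-arg (OccTs-renTs π ts o)

    OccTs-renTs : ∀ {n m k s} (π : Fin n → Fin m) (ts : Vec (Term S n) k) →
                  VecAny.Any (OccT s) (renTs π ts) → VecAny.Any (OccT s) ts
    OccTs-renTs π (t ∷ ts) (here o)  = here (OccT-renT π t o)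
    OccTs-renTs π (t ∷ ts) (there o) = there (OccTs-renTs π ts o)

  OccIn : ∀ {n m} → Sym S → (Fin n → Term S m) → Set
  OccIn {n} s σ = Σ (Fin n) (λ i → OccT s (σ i))

  mutual
    OccT-substT : ∀ {n m s} (σ : Fin n → Term S m) (t : Term S n) → OccT s (substT σ t) →
                  OccT s t ⊎ OccIn s σ
    OccT-substT σ (bvar i)   o         = inj₂ (i , o)
    OccT-substT σ (fvar x)   o-fvar    = inj₁ o-fvar
    OccT-substT σ (par a)    o-par     = inj₁ o-par
    OccT-substT σ (con c)    o-con     = inj₁ o-con
    OccT-substT σ (app f ts) o-fun     = inj₁ o-fun
    OccT-substT σ (app f ts) (o-arg o) = map₁ o-arg (OccTs-substTs σ ts o)

    OccTs-substTs : ∀ {n m k s} (σ : Fin n → Term S m) (ts : Vec (Term S n) k) →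
                    VecAny.Any (OccT s) (substTs σ ts) → VecAny.Any (OccT s) ts ⊎ OccIn s σ
    OccTs-substTs σ (t ∷ ts) (here o)  = map₁ here (OccT-substT σ t o)
    OccTs-substTs σ (t ∷ ts) (there o) = map₁ there (OccTs-substTs σ ts o)

  OccIn-exts : ∀ {n m s} (σ : Fin n → Term S m) → OccIn s (exts σ) → OccIn s σ
  OccIn-exts σ (zero  , ())
  OccIn-exts σ (suc j , o) = j , OccT-renT suc (σ j) o

  OccF-substF : ∀ {n m s} (σ : Fin n → Term S m) (H : Formula S n) → OccF s (substF σ H) →
                OccF s H ⊎ OccIn s σ
  OccF-substF σ (rel r ts) o-rel      = inj₁ o-rel
  OccF-substF σ (rel r ts) (o-rarg o) = map₁ o-rarg (OccTs-substTs σ ts o)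
  OccF-substF σ (s ≐ t)    (o-eql o)  = map₁ o-eql (OccT-substT σ s o)
  OccF-substF σ (s ≐ t)    (o-eqr o)  = map₁ o-eqr (OccT-substT σ t o)
  OccF-substF σ (A ∧' B)   (o-∧l o)   = map₁ o-∧l (OccF-substF σ A o)
  OccF-substF σ (A ∧' B)   (o-∧r o)   = map₁ o-∧r (OccF-substF σ B o)
  OccF-substF σ (A ∨' B)   (o-∨l o)   = map₁ o-∨l (OccF-substF σ A o)
  OccF-substF σ (A ∨' B)   (o-∨r o)   = map₁ o-∨r (OccF-substF σ B o)
  OccF-substF σ (A ⇒' B)   (o-⇒l o)   = map₁ o-⇒l (OccF-substF σ A o)
  OccF-substF σ (A ⇒' B)   (o-⇒r o)   = map₁ o-⇒r (OccF-substF σ B o)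
  OccF-substF σ (∀' A)     (o-∀ o)    = Sum.map o-∀ (OccIn-exts σ) (OccF-substF (exts σ) A o)
  OccF-substF σ (∃' A)     (o-∃ o)    = Sum.map o-∃ (OccIn-exts σ) (OccF-substF (exts σ) A o)

_≟ᴺ_ : (y z : Name) → Dec (y ≡ z)
fv x ≟ᴺ fv y = map′ (cong fv) (λ { refl → refl }) (x ℕ.≟ y)
fv x ≟ᴺ pa b = no (λ ())
pa a ≟ᴺ fv y = no (λ ())
pa a ≟ᴺ pa b = map′ (cong pa) (λ { refl → refl }) (a ℕ.≟ b)

module _ {A : Set} where

  update : (Name → A) → Name → A → Name → A
  update σ y b z with z ≟ᴺ y
  ... | yes _ = b
  ... | no _  = σ z

  update-≡ : (σ : Name → A) (y : Name) (b : A) → update σ y b y ≡ b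
  update-≡ σ y b with y ≟ᴺ y
  ... | yes _  = refl
  ... | no y≢y = ⊥-elim (y≢y refl)

  update-≢ : {σ : Name → A} {y : Name} {b : A} (z : Name) → z ≢ y → update σ y b z ≡ σ z
  update-≢ {y = y} z z≢y with z ≟ᴺ y
  ... | yes z≡y = ⊥-elim (z≢y z≡y)
  ... | no _    = refl

module _ {S : Signature} where

  RenamesInto : (Name → Name) → List (Formula S 0) → List (Formula S 0) → Set
  RenamesInto σ Γ Δ = ∀ {G} → G ∈ Γ → renameF σ G ∈ Δ

  RenamesInto-∷ : ∀ {σ Γ Δ} (A : Formula S 0) → RenamesInto σ Γ Δ → RenamesInto σ (A ∷ Γ) (renameF σ A ∷ Δ)
  RenamesInto-∷ A h (here refl) = here refl
  RenamesInto-∷ A h (there p)   = there (h p)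

  RenamesInto-update : ∀ {σ Γ Δ y} b → Fresh y Γ → RenamesInto σ Γ Δ → RenamesInto (update σ y b) Γ Δ
  RenamesInto-update {Δ = Δ} b y∉Γ h {G} p =
    subst (_∈ Δ) (sym (renameF-fresh G (All.lookup y∉Γ p) update-≢)) (h p)

  renameF-update-inst : (σ : Name → Name) (y b : Name) (F : Formula S 1) → ¬ OccF (nameSym y) F →
                        renameF (update σ y b) (F [ nameT y ]) ≡ (renameF σ F) [ nameT b ]
  renameF-update-inst σ y b F y∉F =
    trans (renameF-inst-fresh F y∉F update-≢) (cong (λ c → _ [ nameT c ]) (update-≡ σ y b))

  -- The eigenvariable y of ∀I and ∃E is mapped to a parameter fresh for the renamed context,
  -- so that the eigenvariable condition survives a non-injective σ.
  ⊢-rename : ∀ {Γ Δ A} (σ : Name → Name) → RenamesInto σ Γ Δ → Γ ⊢ A → Δ ⊢ renameF σ A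
  ⊢-rename σ h (ass p)     = ass (h p)
  ⊢-rename σ h (∧I d e)    = ∧I (⊢-rename σ h d) (⊢-rename σ h e)
  ⊢-rename σ h (∧E₁ d)     = ∧E₁ (⊢-rename σ h d)
  ⊢-rename σ h (∧E₂ d)     = ∧E₂ (⊢-rename σ h d)
  ⊢-rename σ h (∨I₁ d)     = ∨I₁ (⊢-rename σ h d)
  ⊢-rename σ h (∨I₂ d)     = ∨I₂ (⊢-rename σ h d)
  ⊢-rename σ h (∨E {A = A} {B} d e f) =
    ∨E (⊢-rename σ h d) (⊢-rename σ (RenamesInto-∷ A h) e) (⊢-rename σ (RenamesInto-∷ B h) f)
  ⊢-rename σ h (⇒I {A = A} d) = ⇒I (⊢-rename σ (RenamesInto-∷ A h) d)
  ⊢-rename σ h (⇒E d e)    = ⇒E (⊢-rename σ h d) (⊢-rename σ h e)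
  ⊢-rename σ h (⊥I d)      = ⊥I (⊢-rename σ h d)
  ⊢-rename σ h (⊥C {A = A} d) = ⊥C (⊢-rename σ (RenamesInto-∷ (¬' A) h) d)
  ⊢-rename {Δ = Δ} σ h (∀I {F = F} y (y∉∀F ∷ y∉Γ) d) =
    ∀I (pa a) (freshPar-fresh (renameF σ (∀' F) ∷ Δ))
       (subst (Δ ⊢_) (renameF-update-inst σ y (pa a) F (y∉∀F ∘ o-∀))
              (⊢-rename (update σ y (pa a)) (RenamesInto-update (pa a) y∉Γ h) d))
    where a = freshPar (renameF σ (∀' F) ∷ Δ)
  ⊢-rename {Δ = Δ} σ h (∀E {F = F} y d) =
    subst (Δ ⊢_) (sym (renameF-inst σ F y)) (∀E (σ y) (⊢-rename σ h d))
  ⊢-rename {Δ = Δ} σ h (∃I {F = F} y d) =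
    ∃I (σ y) (subst (Δ ⊢_) (renameF-inst σ F y) (⊢-rename σ h d))
  ⊢-rename {Δ = Δ} σ h (∃E {C = C} {F = F} y (y∉∃F ∷ y∉C ∷ y∉Γ) d e) =
    ∃E (pa a) (freshPar-fresh (renameF σ (∃' F) ∷ renameF σ C ∷ Δ)) (⊢-rename σ h d)
       (subst ((renameF σ F) [ par a ] ∷ Δ ⊢_) (renameF-fresh C y∉C update-≢) (⊢-rename σ′ h′ e))
    where
      a  = freshPar (renameF σ (∃' F) ∷ renameF σ C ∷ Δ)
      σ′ = update σ y (pa a)
      h′ : RenamesInto σ′ (F [ nameT y ] ∷ _) ((renameF σ F) [ par a ] ∷ Δ)
      h′ (here refl) = here (renameF-update-inst σ y (pa a) F (y∉∃F ∘ o-∃))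
      h′ (there p)   = there (RenamesInto-update (pa a) y∉Γ h p)

  ⊢-weaken : ∀ {Γ Δ A} → Γ ⊆ Δ → Γ ⊢ A → Δ ⊢ A
  ⊢-weaken {Γ} {Δ} {A} Γ⊆Δ d =
    subst (Δ ⊢_) (renameF-id A)
      (⊢-rename (λ y → y) (λ {G} p → subst (_∈ Δ) (sym (renameF-id G)) (Γ⊆Δ p)) d)

private variable a b : Bool

∧-true⇔ : a ∧ b ≡ true ⇔ (a ≡ true × b ≡ true)
∧-true⇔ {a = true}  = mk⇔ (refl ,_) proj₂
∧-true⇔ {a = false} = mk⇔ (λ ()) (λ ())

∨-true⇔ : a ∨ b ≡ true ⇔ (a ≡ true ⊎ b ≡ true)
∨-true⇔ {a = true}  = mk⇔ (λ _ → inj₁ refl) (λ _ → refl)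
∨-true⇔ {a = false} = mk⇔ inj₂ [ (λ ()) , (λ b≡true → b≡true) ]′

⇒-true⇔ : not a ∨ b ≡ true ⇔ (a ≡ true → b ≡ true)
⇒-true⇔ {a = true}  = mk⇔ (λ b≡true _ → b≡true) (λ f → f refl)
⇒-true⇔ {a = false} = mk⇔ (λ _ ()) (λ _ → refl)

¬¬-true : (not a ∨ false ≡ true → false ≡ true) → a ≡ true
¬¬-true {a = true}  _ = refl
¬¬-true {a = false} f = f refl

does-true⇔ : ∀ {P : Set} (P? : Dec P) → does P? ≡ true ⇔ P
does-true⇔ (yes p) = mk⇔ (λ _ → p) (λ _ → refl)
does-true⇔ (no ¬p) = mk⇔ (λ ()) (λ p → ⊥-elim (¬p p))

Π-⇔ : {A : Set} {P Q : A → Set} → (∀ a → P a ⇔ Q a) → (∀ a → P a) ⇔ (∀ a → Q a)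
Π-⇔ P⇔Q = mk⇔ (λ f a → to (P⇔Q a) (f a)) (λ g a → from (P⇔Q a) (g a))

Σ-⇔ : {A : Set} {P Q : A → Set} → (∀ a → P a ⇔ Q a) → Σ A P ⇔ Σ A Q
Σ-⇔ P⇔Q = mk⇔ (λ (a , p) → a , to (P⇔Q a) p) (λ (a , q) → a , from (P⇔Q a) q)

-- Soundness

module Semantics {S : Signature} (lem : LEM) {Δ : List (Formula S 0)} (v : Valuation Δ) where

  eval : ∀ {n} → Formula S n → (Fin n → ℕ) → Bool
  eval = ⟦_⟧ lem v

  Sat : Formula S 0 → Set
  Sat F = v̄ lem v F ≡ true

  exts-parEnv : ∀ {n m} {σ : Fin n → Term S m} {ρ : Fin m → ℕ} {ρ′ : Fin n → ℕ} →
                (∀ i → substT (parEnv ρ) (σ i) ≡ par (ρ′ i)) → ∀ a i →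
                substT (parEnv (extEnv lem v a ρ)) (exts σ i) ≡ par (extEnv lem v a ρ′ i)
  exts-parEnv e a zero    = refl
  exts-parEnv {σ = σ} e a (suc j) = trans (substT-renT _ suc (σ j)) (e j)

  eval-substF : ∀ {n m} (σ : Fin n → Term S m) {ρ : Fin m → ℕ} {ρ′ : Fin n → ℕ} →
                (∀ i → substT (parEnv ρ) (σ i) ≡ par (ρ′ i)) → (H : Formula S n) →
                eval (substF σ H) ρ ≡ eval H ρ′
  eval-substF σ e ⊥'         = refl
  eval-substF σ e (rel r ts) =
    cong (λ us → atomVal lem v (ratom r us)) (trans (substTs-substTs _ σ ts) (substTs-cong e ts))
  eval-substF σ e (s ≐ t)    =
    cong₂ (λ a b → atomVal lem v (eatom a b))
          (trans (substT-substT _ σ s) (substT-cong e s)) (trans (substT-substT _ σ t) (substT-cong e t))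
  eval-substF σ e (A ∧' B)   = cong₂ _∧_ (eval-substF σ e A) (eval-substF σ e B)
  eval-substF σ e (A ∨' B)   = cong₂ _∨_ (eval-substF σ e A) (eval-substF σ e B)
  eval-substF σ e (A ⇒' B)   = cong₂ (λ a b → not a ∨ b) (eval-substF σ e A) (eval-substF σ e B)
  eval-substF σ e (∀' A)     =
    does-⇔ (mk⇔ (λ f a → trans (sym (body a)) (f a)) (λ f a → trans (body a) (f a))) (lem _) (lem _)
    where body = λ a → eval-substF (exts σ) (exts-parEnv e a) A
  eval-substF σ e (∃' A)     =
    does-⇔ (mk⇔ (λ (a , p) → a , trans (sym (body a)) p) (λ (a , p) → a , trans (body a) p)) (lem _) (lem _)
    where body = λ a → eval-substF (exts σ) (exts-parEnv e a) A

  v̄-inst : (H : Formula S 1) (a : ℕ) (ρ : Fin 0 → ℕ) → v̄ lem v (H [ par a ]) ≡ eval H (extEnv lem v a ρ)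
  v̄-inst H a ρ = eval-substF (λ _ → par a) (λ { zero → refl }) H

  Sat-∀⁺ : (H : Formula S 1) → (∀ a → Sat (H [ par a ])) → Sat (∀' H)
  Sat-∀⁺ H f = from (does-true⇔ (lem _)) (λ a → trans (sym (v̄-inst H a _)) (f a))

  Sat-∀⁻ : (H : Formula S 1) → Sat (∀' H) → ∀ a → Sat (H [ par a ])
  Sat-∀⁻ H p a = trans (v̄-inst H a _) (to (does-true⇔ (lem _)) p a)

  Sat-∃⁺ : (H : Formula S 1) (a : ℕ) → Sat (H [ par a ]) → Sat (∃' H)
  Sat-∃⁺ H a p = from (does-true⇔ (lem _)) (a , trans (sym (v̄-inst H a _)) p)

  Sat-∃⁻ : (H : Formula S 1) → Sat (∃' H) → Σ ℕ (λ a → Sat (H [ par a ]))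
  Sat-∃⁻ H p with to (does-true⇔ (lem _)) p
  ... | a , q = a , trans (v̄-inst H a _) q

  -- Soundness is stated for every renaming of names into parameters: ∀I and ∃E need their
  -- premise for every value of the eigenvariable.
  Holds : (Name → ℕ) → Formula S 0 → Set
  Holds σ G = Sat (renameF (pa ∘ σ) G)

  update-≢-pa : ∀ {σ : Name → ℕ} {y a} z → z ≢ y → pa (update σ y a z) ≡ pa (σ z)
  update-≢-pa z z≢y = cong pa (update-≢ z z≢y)

  Holds-update : ∀ {Γ} {σ : Name → ℕ} {y} a → Fresh y Γ → All (Holds σ) Γ → All (Holds (update σ y a)) Γ
  Holds-update a y∉Γ hs = All.tabulate λ p →
    subst Sat (sym (renameF-fresh _ (All.lookup y∉Γ p) update-≢-pa)) (All.lookup hs p)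

  renameF-update-inst-par : (σ : Name → ℕ) (y : Name) (a : ℕ) (F : Formula S 1) → ¬ OccF (nameSym y) F →
                            renameF (pa ∘ update σ y a) (F [ nameT y ]) ≡ (renameF (pa ∘ σ) F) [ par a ]
  renameF-update-inst-par σ y a F y∉F =
    trans (renameF-inst-fresh F y∉F update-≢-pa)
          (cong (λ b → _ [ par b ]) (update-≡ σ y a))

  soundness : ∀ {Γ A} → Γ ⊢ A → (σ : Name → ℕ) → All (Holds σ) Γ → Holds σ A
  soundness (ass p)  σ hs = All.lookup hs p
  soundness (∧I d e) σ hs = from ∧-true⇔ (soundness d σ hs , soundness e σ hs)
  soundness (∧E₁ d)  σ hs = proj₁ (to ∧-true⇔ (soundness d σ hs))
  soundness (∧E₂ d)  σ hs = proj₂ (to ∧-true⇔ (soundness d σ hs))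
  soundness (∨I₁ d)  σ hs = from ∨-true⇔ (inj₁ (soundness d σ hs))
  soundness (∨I₂ d)  σ hs = from ∨-true⇔ (inj₂ (soundness d σ hs))
  soundness (∨E d e f) σ hs with to ∨-true⇔ (soundness d σ hs)
  ... | inj₁ p = soundness e σ (p ∷ hs)
  ... | inj₂ p = soundness f σ (p ∷ hs)
  soundness (⇒I d)   σ hs = from ⇒-true⇔ (λ p → soundness d σ (p ∷ hs))
  soundness (⇒E d e) σ hs = to ⇒-true⇔ (soundness d σ hs) (soundness e σ hs)
  soundness (⊥I d)   σ hs with () ← soundness d σ hs
  soundness (⊥C d)   σ hs = ¬¬-true (λ p → soundness d σ (p ∷ hs))
  soundness (∀I {F = F} y (y∉∀F ∷ y∉Γ) d) σ hs =
    Sat-∀⁺ (renameF (pa ∘ σ) F) λ a →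
      subst Sat (renameF-update-inst-par σ y a F (y∉∀F ∘ o-∀))
        (soundness d (update σ y a) (Holds-update a y∉Γ hs))
  soundness (∀E {F = F} y d) σ hs =
    subst Sat (sym (renameF-inst (pa ∘ σ) F y)) (Sat-∀⁻ (renameF (pa ∘ σ) F) (soundness d σ hs) (σ y))
  soundness (∃I {F = F} y d) σ hs =
    Sat-∃⁺ (renameF (pa ∘ σ) F) (σ y) (subst Sat (renameF-inst (pa ∘ σ) F y) (soundness d σ hs))
  soundness (∃E {C = C} {F = F} y (y∉∃F ∷ y∉C ∷ y∉Γ) d e) σ hs
    with Sat-∃⁻ (renameF (pa ∘ σ) F) (soundness d σ hs)
  ... | a , p =
    subst Sat (renameF-fresh C y∉C update-≢-pa)
      (soundness e (update σ y a)
        (subst Sat (sym (renameF-update-inst-par σ y a F (y∉∃F ∘ o-∃))) p ∷ Holds-update a y∉Γ hs))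

-- Lindenbaum–Henkin completion of a consistent set along an enumeration

module Lindenbaum {S : Signature} (lem : LEM) (enum : ℕ → List (Formula S 0))
                  (Γ₀ : List (Formula S 0)) (Γ₀-consistent : ¬ (Γ₀ ⊢ ⊥')) where

  Consistent : List (Formula S 0) → Set
  Consistent Γ = ¬ (Γ ⊢ ⊥')

  -- The witness parameter is chosen fresh for the premises of the ∃E that discharges it:
  -- the formula ∃' H, the conclusion ⊥' and the context ∃' H ∷ Γ.
  henkinWitness : Formula S 0 → List (Formula S 0) → List (Formula S 0)
  henkinWitness (∃' H) Γ = H [ par (freshPar (∃' H ∷ ⊥' ∷ ∃' H ∷ Γ)) ] ∷ []
  henkinWitness _      Γ = []

  -- Rejecting ∀' H records a refuted instance, the dual of a Henkin witness.
  counterexample : Formula S 0 → List (Formula S 0) → List (Formula S 0)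
  counterexample (∀' H) Γ = ¬' (H [ par (freshPar (∀' H ∷ Γ)) ]) ∷ []
  counterexample _      Γ = []

  step : List (Formula S 0) → Formula S 0 → List (Formula S 0)
  step Γ φ with lem (Consistent (φ ∷ Γ))
  ... | yes _ = henkinWitness φ Γ ++ φ ∷ Γ
  ... | no _  = counterexample φ Γ ++ Γ

  step-⊇ : ∀ {Γ φ} → Γ ⊆ step Γ φ
  step-⊇ {Γ} {φ} p with lem (Consistent (φ ∷ Γ))
  ... | yes _ = ∈-++⁺ʳ (henkinWitness φ Γ) (there p)
  ... | no _  = ∈-++⁺ʳ (counterexample φ Γ) p

  henkinWitness-consistent : ∀ {Γ} φ → Consistent (φ ∷ Γ) → Consistent (henkinWitness φ Γ ++ φ ∷ Γ)
  henkinWitness-consistent ⊥'         c = c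
  henkinWitness-consistent (rel r ts) c = c
  henkinWitness-consistent (s ≐ t)    c = c
  henkinWitness-consistent (A ∧' B)   c = c
  henkinWitness-consistent (A ∨' B)   c = c
  henkinWitness-consistent (A ⇒' B)   c = c
  henkinWitness-consistent (∀' H)     c = c
  henkinWitness-consistent {Γ} (∃' H) c d =
    c (∃E (pa _) (freshPar-fresh (∃' H ∷ ⊥' ∷ ∃' H ∷ Γ)) (ass (here refl)) d)

  counterexample-consistent : ∀ {Γ} φ → Consistent Γ → ¬ Consistent (φ ∷ Γ) →
                              Consistent (counterexample φ Γ ++ Γ)
  counterexample-consistent ⊥'         c _ = c
  counterexample-consistent (rel r ts) c _ = c
  counterexample-consistent (s ≐ t)    c _ = c
  counterexample-consistent (A ∧' B)   c _ = c
  counterexample-consistent (A ∨' B)   c _ = c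
  counterexample-consistent (A ⇒' B)   c _ = c
  counterexample-consistent (∃' H)     c _ = c
  counterexample-consistent {Γ} (∀' H) c inc d =
    inc (λ d′ → c (⇒E (⇒I d′) (∀I (pa _) (freshPar-fresh (∀' H ∷ Γ)) (⊥C d))))

  step-consistent : ∀ {Γ φ} → Consistent Γ → Consistent (step Γ φ)
  step-consistent {Γ} {φ} c with lem (Consistent (φ ∷ Γ))
  ... | yes c′  = henkinWitness-consistent φ c′
  ... | no  inc = counterexample-consistent φ c inc

  inconsistent⇒refutes : ∀ {Γ φ} → ¬ Consistent (φ ∷ Γ) → Γ ⊢ ¬' φ
  inconsistent⇒refutes {Γ} {φ} inc with lem ((φ ∷ Γ) ⊢ ⊥')
  ... | yes d = ⇒I d
  ... | no nd = ⊥-elim (inc nd)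

  step-decides : ∀ Γ φ → φ ∈ step Γ φ ⊎ Γ ⊢ ¬' φ
  step-decides Γ φ with lem (Consistent (φ ∷ Γ))
  ... | yes _   = inj₁ (∈-++⁺ʳ (henkinWitness φ Γ) (here refl))
  ... | no  inc = inj₂ (inconsistent⇒refutes inc)

  step-∃-decides : ∀ Γ H → Σ ℕ (λ a → H [ par a ] ∈ step Γ (∃' H)) ⊎ Γ ⊢ ¬' (∃' H)
  step-∃-decides Γ H with lem (Consistent (∃' H ∷ Γ))
  ... | yes _   = inj₁ (_ , here refl)
  ... | no  inc = inj₂ (inconsistent⇒refutes inc)

  step-∀-decides : ∀ Γ H → ∀' H ∈ step Γ (∀' H) ⊎ Σ ℕ (λ a → ¬' (H [ par a ]) ∈ step Γ (∀' H))
  step-∀-decides Γ H with lem (Consistent (∀' H ∷ Γ))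
  ... | yes _ = inj₁ (here refl)
  ... | no  _ = inj₂ (_ , here refl)

  run : List (Formula S 0) → List (Formula S 0) → List (Formula S 0)
  run Γ []       = Γ
  run Γ (φ ∷ φs) = run (step Γ φ) φs

  run-⊇ : ∀ Γ φs → Γ ⊆ run Γ φs
  run-⊇ Γ []       p = p
  run-⊇ Γ (φ ∷ φs) p = run-⊇ (step Γ φ) φs (step-⊇ p)

  run-consistent : ∀ Γ φs → Consistent Γ → Consistent (run Γ φs)
  run-consistent Γ []       c = c
  run-consistent Γ (φ ∷ φs) c = run-consistent (step Γ φ) φs (step-consistent c)

  run-processes : ∀ Γ {φ φs} → φ ∈ φs → Σ (List (Formula S 0)) (λ Δ → step Δ φ ⊆ run Γ φs)
  run-processes Γ {φs = ψ ∷ φs} (here refl) = Γ , run-⊇ (step Γ ψ) φs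
  run-processes Γ {φs = ψ ∷ φs} (there p)   = run-processes (step Γ ψ) p

  stage : ℕ → List (Formula S 0)
  stage zero    = Γ₀
  stage (suc k) = run (stage k) (enum k)

  stage-consistent : ∀ k → Consistent (stage k)
  stage-consistent zero    = Γ₀-consistent
  stage-consistent (suc k) = run-consistent (stage k) (enum k) (stage-consistent k)

  stage-mono : ∀ {j k} → j ≤ k → stage j ⊆ stage k
  stage-mono j≤k = go (≤⇒≤′ j≤k)
    where
      go : ∀ {j k} → j ≤′ k → stage j ⊆ stage k
      go ≤′-refl                p = p
      go {k = suc k} (≤′-step q) p = run-⊇ (stage k) (enum k) (go q p)

  Member : Formula S 0 → Set
  Member φ = Σ ℕ (λ k → φ ∈ stage k)

  Derivable : Formula S 0 → Set
  Derivable φ = Σ ℕ (λ k → stage k ⊢ φ)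

  Enumerated : Formula S 0 → Set
  Enumerated φ = Σ ℕ (λ k → φ ∈ enum k)

  member⇒derivable : ∀ {φ} → Member φ → Derivable φ
  member⇒derivable (k , p) = k , ass p

  derivable-map : ∀ {A C} → (∀ {Γ} → Γ ⊢ A → Γ ⊢ C) → Derivable A → Derivable C
  derivable-map f (k , d) = k , f d

  derivable-map₂ : ∀ {A B C} → (∀ {Γ} → Γ ⊢ A → Γ ⊢ B → Γ ⊢ C) → Derivable A → Derivable B → Derivable C
  derivable-map₂ f (j , d) (k , e) =
    j ⊔ k , f (⊢-weaken (stage-mono (m≤m⊔n j k)) d) (⊢-weaken (stage-mono (m≤n⊔m j k)) e)

  ¬derivable-⊥ : ¬ Derivable ⊥'
  ¬derivable-⊥ (k , d) = stage-consistent k d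

  ¬derivable-refuted : ∀ {φ} → Derivable φ → ¬ Derivable (¬' φ)
  ¬derivable-refuted d r = ¬derivable-⊥ (derivable-map₂ (λ d r → ⇒E r d) d r)

  processed : ∀ {φ} → Enumerated φ → Σ ℕ (λ k → Σ (List (Formula S 0)) (λ Δ → step Δ φ ⊆ stage k))
  processed (k , p) = suc k , run-processes (stage k) p

  enumerated-decided : ∀ {φ} → Enumerated φ → Member φ ⊎ Derivable (¬' φ)
  enumerated-decided {φ} e with processed e
  ... | k , Δ , s = Sum.map (λ p → k , s p) (λ r → k , ⊢-weaken (s ∘ step-⊇) r) (step-decides Δ φ)

  derivable⇒member : ∀ {φ} → Enumerated φ → Derivable φ → Member φ
  derivable⇒member e d with enumerated-decided e
  ... | inj₁ m = m
  ... | inj₂ r = ⊥-elim (¬derivable-refuted d r)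

  nonmember⇒refuted : ∀ {φ} → Enumerated φ → ¬ Member φ → Derivable (¬' φ)
  nonmember⇒refuted e ∉ with enumerated-decided e
  ... | inj₁ m = ⊥-elim (∉ m)
  ... | inj₂ r = r

  member-∃-witness : ∀ {H} → Enumerated (∃' H) → Member (∃' H) → Σ ℕ (λ a → Member (H [ par a ]))
  member-∃-witness {H} e m with processed e
  ... | k , Δ , s with step-∃-decides Δ H
  ... | inj₁ (a , p) = a , k , s p
  ... | inj₂ r       = ⊥-elim (¬derivable-refuted (member⇒derivable m) (k , ⊢-weaken (s ∘ step-⊇) r))

  nonmember-∀-counterexample : ∀ {H} → Enumerated (∀' H) → ¬ Member (∀' H) →
                               Σ ℕ (λ a → Member (¬' (H [ par a ])))
  nonmember-∀-counterexample {H} e ∉ with processed e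
  ... | k , Δ , s with step-∀-decides Δ H
  ... | inj₁ p       = ⊥-elim (∉ (k , s p))
  ... | inj₂ (a , p) = a , k , s p

  ¬member-⊥ : ¬ Member ⊥'
  ¬member-⊥ m = ¬derivable-⊥ (member⇒derivable m)

  module _ {φ ψ : Formula S 0} (eφ : Enumerated φ) (eψ : Enumerated ψ) where

    member-∧ : Enumerated (φ ∧' ψ) → Member (φ ∧' ψ) ⇔ (Member φ × Member ψ)
    member-∧ e = mk⇔
      (λ m → derivable⇒member eφ (derivable-map ∧E₁ (member⇒derivable m))
           , derivable⇒member eψ (derivable-map ∧E₂ (member⇒derivable m)))
      (λ (m , m′) → derivable⇒member e (derivable-map₂ ∧I (member⇒derivable m) (member⇒derivable m′)))

    member-∨ : Enumerated (φ ∨' ψ) → Member (φ ∨' ψ) ⇔ (Member φ ⊎ Member ψ)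
    member-∨ e = mk⇔ split
      [ (λ m → derivable⇒member e (derivable-map ∨I₁ (member⇒derivable m)))
      , (λ m → derivable⇒member e (derivable-map ∨I₂ (member⇒derivable m))) ]′
      where
        disjunctive-syllogism : ∀ {Γ} → Γ ⊢ φ ∨' ψ → Γ ⊢ ¬' φ → Γ ⊢ ψ
        disjunctive-syllogism d r = ∨E d (⊥I (⇒E (⊢-weaken there r) (ass (here refl)))) (ass (here refl))

        split : Member (φ ∨' ψ) → Member φ ⊎ Member ψ
        split m with lem (Member φ)
        ... | yes mφ = inj₁ mφ
        ... | no ∉φ  = inj₂ (derivable⇒member eψ
                         (derivable-map₂ disjunctive-syllogism (member⇒derivable m) (nonmember⇒refuted eφ ∉φ)))

    member-⇒ : Enumerated (φ ⇒' ψ) → Member (φ ⇒' ψ) ⇔ (Member φ → Member ψ)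
    member-⇒ e = mk⇔
      (λ m mφ → derivable⇒member eψ (derivable-map₂ ⇒E (member⇒derivable m) (member⇒derivable mφ)))
      intro
      where
        intro : (Member φ → Member ψ) → Member (φ ⇒' ψ)
        intro f with lem (Member φ)
        ... | yes mφ = derivable⇒member e (derivable-map (⇒I ∘ ⊢-weaken there) (member⇒derivable (f mφ)))
        ... | no ∉φ  = derivable⇒member e
                         (derivable-map (λ r → ⇒I (⊥I (⇒E (⊢-weaken there r) (ass (here refl)))))
                                        (nonmember⇒refuted eφ ∉φ))

  module _ {H : Formula S 1} (eH : ∀ a → Enumerated (H [ par a ])) where

    member-∀ : Enumerated (∀' H) → Member (∀' H) ⇔ (∀ a → Member (H [ par a ]))
    member-∀ e = mk⇔ (λ m a → derivable⇒member (eH a) (derivable-map (∀E (pa a)) (member⇒derivable m))) gen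
      where
        gen : (∀ a → Member (H [ par a ])) → Member (∀' H)
        gen f with lem (Member (∀' H))
        ... | yes m = m
        ... | no ∉  with nonmember-∀-counterexample e ∉
        ...   | a , m = ⊥-elim (¬derivable-refuted (member⇒derivable (f a)) (member⇒derivable m))

    member-∃ : Enumerated (∃' H) → Member (∃' H) ⇔ Σ ℕ (λ a → Member (H [ par a ]))
    member-∃ e = mk⇔ (member-∃-witness e)
      (λ (a , m) → derivable⇒member e (derivable-map (∃I (pa a)) (member⇒derivable m)))

envs : (n k : ℕ) → List (Fin n → ℕ)
envs zero    k = (λ ()) ∷ []
envs (suc n) k = concatMap (λ a → map (a ∷ᵉ_) (envs n k)) (upTo k)

envs-complete : ∀ n {k} (ρ : Fin n → ℕ) → (∀ i → ρ i < k) →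
                Σ (Fin n → ℕ) (λ ρ′ → ρ′ ∈ envs n k × (∀ i → ρ′ i ≡ ρ i))
envs-complete zero    ρ _ = (λ ()) , here refl , λ ()
envs-complete (suc n) {k} ρ ρ<k with envs-complete n (ρ ∘ suc) (ρ<k ∘ suc)
... | ρ′ , ρ′∈ , ρ′≗ρ =
  ρ zero ∷ᵉ ρ′ ,
  ∈-concatMap⁺ (λ a → map (a ∷ᵉ_) (envs n k))
               (ListAny.map (λ { refl → ∈-map⁺ (ρ zero ∷ᵉ_) ρ′∈ }) (∈-upTo⁺ (ρ<k zero))) ,
  λ { zero → refl ; (suc i) → ρ′≗ρ i }

envBound : ∀ {n} → (Fin n → ℕ) → ℕ
envBound {zero}  ρ = 0
envBound {suc n} ρ = suc (ρ zero) ⊔ envBound (ρ ∘ suc)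

envBound-> : ∀ {n} (ρ : Fin n → ℕ) i → ρ i < envBound ρ
envBound-> ρ zero    = m≤m⊔n (suc (ρ zero)) (envBound (ρ ∘ suc))
envBound-> ρ (suc i) = ≤-trans (envBound-> (ρ ∘ suc) i) (m≤n⊔m (suc (ρ zero)) (envBound (ρ ∘ suc)))

module _ {S : Signature} where

  infix 3 _≼_
  data _≼_ {n} (A : Formula S n) : ∀ {m} → Formula S m → Set where
    ≼-refl : A ≼ A
    ≼∧l    : ∀ {m} {B C : Formula S m} → A ≼ B → A ≼ B ∧' C
    ≼∧r    : ∀ {m} {B C : Formula S m} → A ≼ C → A ≼ B ∧' C
    ≼∨l    : ∀ {m} {B C : Formula S m} → A ≼ B → A ≼ B ∨' C
    ≼∨r    : ∀ {m} {B C : Formula S m} → A ≼ C → A ≼ B ∨' C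
    ≼⇒l    : ∀ {m} {B C : Formula S m} → A ≼ B → A ≼ B ⇒' C
    ≼⇒r    : ∀ {m} {B C : Formula S m} → A ≼ C → A ≼ B ⇒' C
    ≼∀     : ∀ {m} {B : Formula S (suc m)} → A ≼ B → A ≼ ∀' B
    ≼∃     : ∀ {m} {B : Formula S (suc m)} → A ≼ B → A ≼ ∃' B

  ≼-trans : ∀ {n m k} {A : Formula S n} {B : Formula S m} {G : Formula S k} → A ≼ B → B ≼ G → A ≼ G
  ≼-trans p ≼-refl  = p
  ≼-trans p (≼∧l q) = ≼∧l (≼-trans p q)
  ≼-trans p (≼∧r q) = ≼∧r (≼-trans p q)
  ≼-trans p (≼∨l q) = ≼∨l (≼-trans p q)
  ≼-trans p (≼∨r q) = ≼∨r (≼-trans p q)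
  ≼-trans p (≼⇒l q) = ≼⇒l (≼-trans p q)
  ≼-trans p (≼⇒r q) = ≼⇒r (≼-trans p q)
  ≼-trans p (≼∀ q)  = ≼∀ (≼-trans p q)
  ≼-trans p (≼∃ q)  = ≼∃ (≼-trans p q)

  OccF-≼ : ∀ {n m s} {A : Formula S n} {G : Formula S m} → A ≼ G → OccF s A → OccF s G
  OccF-≼ ≼-refl  o = o
  OccF-≼ (≼∧l q) o = o-∧l (OccF-≼ q o)
  OccF-≼ (≼∧r q) o = o-∧r (OccF-≼ q o)
  OccF-≼ (≼∨l q) o = o-∨l (OccF-≼ q o)
  OccF-≼ (≼∨r q) o = o-∨r (OccF-≼ q o)
  OccF-≼ (≼⇒l q) o = o-⇒l (OccF-≼ q o)
  OccF-≼ (≼⇒r q) o = o-⇒r (OccF-≼ q o)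
  OccF-≼ (≼∀ q)  o = o-∀ (OccF-≼ q o)
  OccF-≼ (≼∃ q)  o = o-∃ (OccF-≼ q o)

  OccF-closeF : ∀ {n s} (ρ : Fin n → ℕ) (H : Formula S n) → OccF s (closeF ρ H) →
                OccF s H ⊎ Σ ℕ (λ a → s ≡ spar a)
  OccF-closeF ρ H o with OccF-substF (parEnv ρ) H o
  ... | inj₁ o′          = inj₁ o′
  ... | inj₂ (i , o-par) = inj₂ (ρ i , refl)

  instancesBelow : ∀ {n} → ℕ → Formula S n → List (Formula S 0)
  instancesBelow {n} k H = map (λ ρ → closeF ρ H) (envs n k)

  mutual
    subInstancesBelow : ∀ {n} → ℕ → Formula S n → List (Formula S 0)
    subInstancesBelow k H = instancesBelow k H ++ properSubInstancesBelow k H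

    properSubInstancesBelow : ∀ {n} → ℕ → Formula S n → List (Formula S 0)
    properSubInstancesBelow k ⊥'         = []
    properSubInstancesBelow k (rel r ts) = []
    properSubInstancesBelow k (s ≐ t)    = []
    properSubInstancesBelow k (A ∧' B)   = subInstancesBelow k A ++ subInstancesBelow k B
    properSubInstancesBelow k (A ∨' B)   = subInstancesBelow k A ++ subInstancesBelow k B
    properSubInstancesBelow k (A ⇒' B)   = subInstancesBelow k A ++ subInstancesBelow k B
    properSubInstancesBelow k (∀' A)     = subInstancesBelow k A
    properSubInstancesBelow k (∃' A)     = subInstancesBelow k A

  properSubInstancesBelow-⊆ : ∀ {n k} (G : Formula S n) → properSubInstancesBelow k G ⊆ subInstancesBelow k G
  properSubInstancesBelow-⊆ {k = k} G = ∈-++⁺ʳ (instancesBelow k G)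

  subInstancesBelow-≼ : ∀ {n m k} {A : Formula S n} {G : Formula S m} → A ≼ G →
                        subInstancesBelow k A ⊆ subInstancesBelow k G
  subInstancesBelow-≼ ≼-refl p = p
  subInstancesBelow-≼ {G = G} (≼∧l q) p = properSubInstancesBelow-⊆ G (∈-++⁺ˡ (subInstancesBelow-≼ q p))
  subInstancesBelow-≼ {G = G} (≼∨l q) p = properSubInstancesBelow-⊆ G (∈-++⁺ˡ (subInstancesBelow-≼ q p))
  subInstancesBelow-≼ {G = G} (≼⇒l q) p = properSubInstancesBelow-⊆ G (∈-++⁺ˡ (subInstancesBelow-≼ q p))
  subInstancesBelow-≼ {k = k} {G = G@(B ∧' _)} (≼∧r q) p =
    properSubInstancesBelow-⊆ G (∈-++⁺ʳ (subInstancesBelow k B) (subInstancesBelow-≼ q p))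
  subInstancesBelow-≼ {k = k} {G = G@(B ∨' _)} (≼∨r q) p =
    properSubInstancesBelow-⊆ G (∈-++⁺ʳ (subInstancesBelow k B) (subInstancesBelow-≼ q p))
  subInstancesBelow-≼ {k = k} {G = G@(B ⇒' _)} (≼⇒r q) p =
    properSubInstancesBelow-⊆ G (∈-++⁺ʳ (subInstancesBelow k B) (subInstancesBelow-≼ q p))
  subInstancesBelow-≼ {G = G} (≼∀ q) p = properSubInstancesBelow-⊆ G (subInstancesBelow-≼ q p)
  subInstancesBelow-≼ {G = G} (≼∃ q) p = properSubInstancesBelow-⊆ G (subInstancesBelow-≼ q p)

  closeF-∈-subInstancesBelow : ∀ {n m} {H : Formula S n} {G : Formula S m} → H ≼ G → (ρ : Fin n → ℕ) →
                               closeF ρ H ∈ subInstancesBelow (envBound ρ) G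
  closeF-∈-subInstancesBelow {n} {H = H} H≼G ρ with envs-complete n ρ (envBound-> ρ)
  ... | ρ′ , ρ′∈ , ρ′≗ρ =
    subst (_∈ _) (substF-cong (cong par ∘ ρ′≗ρ) H)
          (subInstancesBelow-≼ H≼G (∈-++⁺ˡ (∈-map⁺ (λ ρ → closeF ρ H) ρ′∈)))

-- Completeness

¬LangSym-spar : ∀ {S a} → ¬ LangSym {S} (spar a)
¬LangSym-spar ()

-- The canonical valuation makes an atom true iff it enters the Lindenbaum completion of
-- ¬F, Gs; only instances of subformulas of ¬F, Gs need to be enumerated, which keeps every
-- atom met by the truth lemma pure and inside L(Gs, F).
module Completeness {S : Signature} (lem : LEM) (Gs : List (Formula S 0)) (F : Formula S 0)
                    (Gs-pure : All Pure Gs) (F-pure : Pure F) (¬F,Gs-consistent : ¬ (¬' F ∷ Gs ⊢ ⊥')) where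

  Γ₀ : List (Formula S 0)
  Γ₀ = ¬' F ∷ Gs

  Γ₀-pure : ∀ {G} → G ∈ Γ₀ → Pure G
  Γ₀-pure (here refl) x (o-⇒l o) = F-pure x o
  Γ₀-pure (here refl) x (o-⇒r ())
  Γ₀-pure (there p)   = All.lookup Gs-pure p

  Γ₀-symbol : ∀ {G s} → G ∈ Γ₀ → OccF s G → ListAny.Any (OccF s) (F ∷ Gs)
  Γ₀-symbol (here refl) (o-⇒l o) = here o
  Γ₀-symbol (here refl) (o-⇒r ())
  Γ₀-symbol (there p)   o        = there (ListAny.map (λ { refl → o }) p)

  enum : ℕ → List (Formula S 0)
  enum k = concatMap (subInstancesBelow k) Γ₀

  open Lindenbaum lem enum Γ₀ ¬F,Gs-consistent

  module _ {n G} {H : Formula S n} (G∈Γ₀ : G ∈ Γ₀) (H≼G : H ≼ G) (ρ : Fin n → ℕ) where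

    enumerated : Enumerated (closeF ρ H)
    enumerated = envBound ρ , ∈-concatMap⁺ (subInstancesBelow (envBound ρ))
                                           (ListAny.map (λ { refl → closeF-∈-subInstancesBelow H≼G ρ }) G∈Γ₀)

    closeF-pure : Pure (closeF ρ H)
    closeF-pure x o with OccF-closeF ρ H o
    ... | inj₁ o′     = Γ₀-pure G∈Γ₀ x (OccF-≼ H≼G o′)
    ... | inj₂ (_ , ())

    closeF-inLang : ∀ s → LangSym s → OccF s (closeF ρ H) → ListAny.Any (OccF s) (F ∷ Gs)
    closeF-inLang s l o with OccF-closeF ρ H o
    ... | inj₁ o′         = Γ₀-symbol G∈Γ₀ (OccF-≼ H≼G o′)
    ... | inj₂ (_ , refl) = ⊥-elim (¬LangSym-spar l)

  canonical : Valuation (F ∷ Gs)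
  canonical A _ _ = does (lem (Member (atomF A)))

  open Semantics lem canonical

  truth-atom : (A : Atom) → PureAtom A → InLang (F ∷ Gs) A →
               atomVal lem canonical A ≡ true ⇔ Member (atomF A)
  truth-atom A p l with lem (PureAtom A × InLang (F ∷ Gs) A)
  ... | yes _  = does-true⇔ (lem _)
  ... | no ¬pl = ⊥-elim (¬pl (p , l))

  enumerated-inst : ∀ {n G} (H : Formula S (suc n)) → G ∈ Γ₀ → H ≼ G → ∀ ρ a →
                    Enumerated (substF (exts (parEnv ρ)) H [ par a ])
  enumerated-inst H g s ρ a =
    subst Enumerated (sym (closeF-inst H ρ (extEnv lem canonical a ρ) (λ _ → refl))) (enumerated g s _)

  mutual
    truth : ∀ {n G} (H : Formula S n) → G ∈ Γ₀ → H ≼ G → ∀ ρ → eval H ρ ≡ true ⇔ Member (closeF ρ H)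
    truth ⊥'         g s ρ = mk⇔ (λ ()) (⊥-elim ∘ ¬member-⊥)
    truth (rel r ts) g s ρ = truth-atom (ratom r _) (closeF-pure g s ρ) (closeF-inLang g s ρ)
    truth (t ≐ u)    g s ρ = truth-atom (eatom _ _) (closeF-pure g s ρ) (closeF-inLang g s ρ)
    truth (A ∧' B)   g s ρ =
      ⇔-trans ∧-true⇔ (⇔-trans (truth A g sA ρ ×-⇔ truth B g sB ρ)
        (⇔-sym (member-∧ (enumerated g sA ρ) (enumerated g sB ρ) (enumerated g s ρ))))
      where sA = ≼-trans (≼∧l ≼-refl) s; sB = ≼-trans (≼∧r ≼-refl) s
    truth (A ∨' B)   g s ρ =
      ⇔-trans ∨-true⇔ (⇔-trans (truth A g sA ρ ⊎-⇔ truth B g sB ρ)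
        (⇔-sym (member-∨ (enumerated g sA ρ) (enumerated g sB ρ) (enumerated g s ρ))))
      where sA = ≼-trans (≼∨l ≼-refl) s; sB = ≼-trans (≼∨r ≼-refl) s
    truth (A ⇒' B)   g s ρ =
      ⇔-trans ⇒-true⇔ (⇔-trans (→-cong-⇔ (truth A g sA ρ) (truth B g sB ρ))
        (⇔-sym (member-⇒ (enumerated g sA ρ) (enumerated g sB ρ) (enumerated g s ρ))))
      where sA = ≼-trans (≼⇒l ≼-refl) s; sB = ≼-trans (≼⇒r ≼-refl) s
    truth (∀' H)     g s ρ =
      ⇔-trans (does-true⇔ (lem _)) (⇔-trans (Π-⇔ (truth-inst H g sH ρ))
        (⇔-sym (member-∀ (enumerated-inst H g sH ρ) (enumerated g s ρ))))
      where sH = ≼-trans (≼∀ ≼-refl) s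
    truth (∃' H)     g s ρ =
      ⇔-trans (does-true⇔ (lem _)) (⇔-trans (Σ-⇔ (truth-inst H g sH ρ))
        (⇔-sym (member-∃ (enumerated-inst H g sH ρ) (enumerated g s ρ))))
      where sH = ≼-trans (≼∃ ≼-refl) s

    truth-inst : ∀ {n G} (H : Formula S (suc n)) → G ∈ Γ₀ → H ≼ G → ∀ ρ a →
                 eval H (extEnv lem canonical a ρ) ≡ true ⇔ Member (substF (exts (parEnv ρ)) H [ par a ])
    truth-inst H g s ρ a =
      subst (λ φ → eval H (extEnv lem canonical a ρ) ≡ true ⇔ Member φ)
            (sym (closeF-inst H ρ (extEnv lem canonical a ρ) (λ _ → refl))) (truth H g s _)

  not-consequence : ¬ TvConsequence lem Gs F
  not-consequence tv = ¬derivable-refuted (member⇒derivable F-member) (0 , ass (here refl))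
    where
      Gs-sat : All Sat Gs
      Gs-sat = All.tabulate λ {G} p →
        from (truth G (there p) ≼-refl (λ ())) (0 , there (subst (_∈ Gs) (sym (substF-closed _ G)) p))
      F-member : Member F
      F-member = subst Member (substF-closed _ F)
                   (to (truth F (here refl) (≼⇒l ≼-refl) (λ ())) (tv canonical Gs-sat))

module _ {S : Signature} (lem : LEM) {Gs : List (Formula S 0)} {F : Formula S 0}
         (Gs-pure : All Pure Gs) (F-pure : Pure F) where

  tv-sound : Gs ⊢ F → TvConsequence lem Gs F
  tv-sound d v Gs-sat =
    subst Sat (renameF-pure F F-pure λ _ → refl)
      (soundness d fixPars (All.zipWith (λ (pure , sat) → subst Sat (sym (renameF-pure _ pure λ _ → refl)) sat)
                                         (Gs-pure , Gs-sat)))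
    where
      open Semantics lem v
      -- the image of free variables is irrelevant: none occur in pure formulae
      fixPars : Name → ℕ
      fixPars (fv _) = 0
      fixPars (pa a) = a

  tv-complete : TvConsequence lem Gs F → Gs ⊢ F
  tv-complete tv with lem (¬' F ∷ Gs ⊢ ⊥')
  ... | yes d = ⊥C d
  ... | no ¬F,Gs-consistent = ⊥-elim (Completeness.not-consequence lem Gs F Gs-pure F-pure ¬F,Gs-consistent tv)

mainTheorem4 : (S : Signature) (lem : LEM) (Gs : List (Formula S 0)) (F : Formula S 0) →
    All Pure Gs → Pure F →
    ((Gs ⊢ F) → TvConsequence lem Gs F) × (TvConsequence lem Gs F → (Gs ⊢ F))
mainTheorem4 S lem Gs F Gs-pure F-pure = tv-sound lem Gs-pure F-pure , tv-complete lem Gs-pure F-pure
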